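{- The chirality index of any orientably regular hypermap divides its number of darts.
   Context: Let $\Delta=\langle r_0,r_1,r_2\mid r_0^2=r_1^2=r_2^2=1\rangle$ and let $\Delta^+$ be its index-$2$ subgroup of even-length words, generated by $\rho=r_1r_2$ and $\lambda=r_2r_0$. An (oriented) hypermap is a triple $\mathcal H=(D,R,L)$ with $D$ a finite set (the darts) and $R,L$ permutations of $D$ such that $\langle R,L\rangle$ is transitive on $D$. It is orientably regular if its automorphism group (permutations of $D$ commuting with $R$ and $L$) acts regularly on $D$; then $\mathcal H\cong(\Delta^+/H,\rho,\lambda)$ (left multiplication on cosets) for a unique normal subgroup $H$ of finite index in $\Delta^+$ (the hypermap subgroup). For $H\trianglelefteq\Delta^+$ put $H^r=r_2Hr_2$. The chirality index is $\kappa=|HH^r/H|$. -}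

module Defs where

open import Data.Nat using (ℕ)
open import Data.Fin using (Fin)
open import Data.Fin.Permutation using (Permutation′; _⟨$⟩ʳ_; _⟨$⟩ˡ_)
open import Data.List using (List; []; _∷_; _++_; map; reverse)
open import Data.Product using (Σ; ∃; _×_)
open import Relation.Binary.PropositionalEquality using (_≡_)

-- The group Δ⁺ = ⟨ρ, λ⟩ (free of rank 2).  Elements are represented by
-- words in the letters ρ, ρ⁻¹, λ, λ⁻¹; equality in Δ⁺ is the free
-- equivalence _≈_ below (cancellation of x x⁻¹ anywhere in a word).

data Letter : Set where
  ρ⁺ ρ⁻ λ⁺ λ⁻ : Letter

Word : Set
Word = List Letter

flipL : Letter → Letter
flipL ρ⁺ = ρ⁻
flipL ρ⁻ = ρ⁺
flipL λ⁺ = λ⁻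
flipL λ⁻ = λ⁺

inv : Word → Word
inv w = reverse (map flipL w)

data _⟶_ : Word → Word → Set where
  cancel : ∀ u x v → (u ++ x ∷ flipL x ∷ v) ⟶ (u ++ v)

data _≈_ : Word → Word → Set where
  ≈-refl  : ∀ {w} → w ≈ w
  ≈-step  : ∀ {u v w} → u ⟶ v → v ≈ w → u ≈ w
  ≈-back  : ∀ {u v w} → v ⟶ u → v ≈ w → u ≈ w

-- Conjugation by r₂ on Δ⁺:  r₂ ρ r₂ = r₂ r₁ = ρ⁻¹ and r₂ λ r₂ = r₀ r₂ = λ⁻¹,
-- so h ↦ r₂ h r₂ replaces every letter by its inverse (order kept).
conjR₂ : Word → Word
conjR₂ w = map flipL w

module _ {n : ℕ} (R L : Permutation′ n) where

  actL : Letter → Fin n → Fin n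
  actL ρ⁺ d = R ⟨$⟩ʳ d
  actL ρ⁻ d = R ⟨$⟩ˡ d
  actL λ⁺ d = L ⟨$⟩ʳ d
  actL λ⁻ d = L ⟨$⟩ˡ d

  act : Word → Fin n → Fin n
  act []      d = d
  act (x ∷ w) d = actL x (act w d)

  Transitive : Set
  Transitive = ∀ (d d′ : Fin n) → ∃ λ w → act w d ≡ d′

  IsAutomorphism : Permutation′ n → Set
  IsAutomorphism f =
    (∀ d → f ⟨$⟩ʳ (R ⟨$⟩ʳ d) ≡ R ⟨$⟩ʳ (f ⟨$⟩ʳ d)) ×
    (∀ d → f ⟨$⟩ʳ (L ⟨$⟩ʳ d) ≡ L ⟨$⟩ʳ (f ⟨$⟩ʳ d))

  OrientablyRegular : Set
  OrientablyRegular =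
    (∀ (d d′ : Fin n) → Σ (Permutation′ n) λ f → IsAutomorphism f × f ⟨$⟩ʳ d ≡ d′) ×
    (∀ (f : Permutation′ n) → IsAutomorphism f →
       ∀ d → f ⟨$⟩ʳ d ≡ d → ∀ x → f ⟨$⟩ʳ x ≡ x)

  module _ (d₀ : Fin n) where

    -- hypermap subgroup H: stabiliser of the base dart d₀
    -- (ℋ ≅ Δ⁺/H via w H ↦ w · d₀)
    InH : Word → Set
    InH w = act w d₀ ≡ d₀

    InHr : Word → Set
    InHr w = ∃ λ h → InH h × w ≡ conjR₂ h

    InHHr : Word → Set
    InHHr w = ∃ λ h → ∃ λ h′ → InH h × InHr h′ × w ≈ (h ++ h′)

    SameCoset : Word → Word → Set
    SameCoset w w′ = InH (inv w ++ w′)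

    -- κ = |HH^r / H| : f lists the cosets of H in HH^r, each exactly once
    IsChiralityIndex : ℕ → Set
    IsChiralityIndex κ =
      Σ (Fin κ → Σ Word InHHr) λ f →
        (∀ i j → SameCoset (Σ.proj₁ (f i)) (Σ.proj₁ (f j)) → i ≡ j) ×
        (∀ (x : Σ Word InHHr) → ∃ λ i → SameCoset (Σ.proj₁ (f i)) (Σ.proj₁ x))

{-# OPTIONS --safe #-}
-- Every automorphism commutes with the action of Δ⁺ on darts, and automorphisms move d₀
-- to any dart, so the stabiliser H of d₀ fixes every dart. Hence a word of H H^r
-- acts like its H^r-factor, and two words act alike at one dart iff they lie in the same
-- coset of H. The κ coset representatives of H H^r / H therefore send each dart to κ
-- distinct darts, which make up its H^r-orbit: the darts split into H^r-orbits of size κ.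
module Submission where

open import Data.Fin using (Fin; zero; suc; _≟_)
open import Data.Fin.Permutation using (Permutation′; _⟨$⟩ʳ_; _⟨$⟩ˡ_; inverseˡ; inverseʳ)
open import Data.Fin.Properties using (any?; suc-injective; 0≢1+n)
open import Data.List using ([]; _∷_; _++_; map)
open import Data.List.Properties using (unfold-reverse; map-++; reverse-map)
open import Data.Nat using (ℕ; zero; suc; _+_; _<_; z<s)
open import Data.Nat.Divisibility using (_∣_; _∣0; ∣-refl; ∣m∣n⇒∣m+n)
open import Data.Nat.Induction using (<-wellFounded)
open import Data.Nat.Properties using (+-comm; +-suc; m<n+m)
open import Data.Product using (Σ; ∃; _×_; _,_; proj₁; proj₂)
open import Function using (_∘_)
open import Function.Definitions using (Injective)
open import Induction.WellFounded using (Acc; acc)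
open import Level using (Level; 0ℓ)
open import Relation.Binary.Core using (Rel)
open import Relation.Binary.Definitions using (_Respects_)
open import Relation.Binary.PropositionalEquality
open import Relation.Binary.Structures using (IsEquivalence)
open import Relation.Nullary using (yes; no; contradiction)
open import Relation.Nullary.Decidable using (map′)
open import Relation.Unary using (Pred; Decidable; Empty; _≐_; _∩_; ∁)
open import Relation.Unary.Properties using (_∩?_; ∁?; U?)

open import Defs

private variable
  ℓ ℓ′ : Level
  n k : ℕ

count : {P : Pred (Fin n) ℓ} → Decidable P → ℕ
count {zero}  P? = 0
count {suc n} P? with P? zero
... | yes _ = suc (count (P? ∘ suc))
... | no _  = count (P? ∘ suc)

count-cong : {P : Pred (Fin n) ℓ} {Q : Pred (Fin n) ℓ′} (P? : Decidable P) (Q? : Decidable Q) →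
             P ≐ Q → count P? ≡ count Q?
count-cong {zero}  P? Q? P≐Q = refl
count-cong {suc n} P? Q? (P⊆Q , Q⊆P) with P? zero | Q? zero
... | yes _ | yes _ = cong suc (count-cong (P? ∘ suc) (Q? ∘ suc) (P⊆Q , Q⊆P))
... | no _  | no _  = count-cong (P? ∘ suc) (Q? ∘ suc) (P⊆Q , Q⊆P)
... | yes p | no ¬q = contradiction (P⊆Q p) ¬q
... | no ¬p | yes q = contradiction (Q⊆P q) ¬p

count-empty : {P : Pred (Fin n) ℓ} (P? : Decidable P) → Empty P → count P? ≡ 0
count-empty {zero}  P? ∅ = refl
count-empty {suc n} P? ∅ with P? zero
... | yes p = contradiction p (∅ zero)
... | no _  = count-empty (P? ∘ suc) (∅ ∘ suc)

count-U : count (U? {A = Fin n}) ≡ n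
count-U {zero}  = refl
count-U {suc n} = cong suc (count-U {n})

count-pos : {P : Pred (Fin n) ℓ} (P? : Decidable P) {x : Fin n} → P x → 0 < count P?
count-pos P? {zero} px with P? zero
... | yes _ = z<s
... | no ¬p = contradiction px ¬p
count-pos P? {suc x} px with P? zero
... | yes _ = z<s
... | no _  = count-pos (P? ∘ suc) px

count-split : {P : Pred (Fin n) ℓ} {Q : Pred (Fin n) ℓ′} (P? : Decidable P) (Q? : Decidable Q) →
              count P? ≡ count (P? ∩? Q?) + count (P? ∩? ∁? Q?)
count-split {zero}  P? Q? = refl
count-split {suc n} P? Q? with P? zero | Q? zero | count-split (P? ∘ suc) (Q? ∘ suc)
... | yes _ | yes _ | ih = cong suc ih
... | yes _ | no _  | ih = trans (cong suc ih) (sym (+-suc _ _))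
... | no _  | yes _ | ih = ih
... | no _  | no _  | ih = ih

count-singleton : (a : Fin n) → count (a ≟_) ≡ 1
count-singleton {suc n} zero    = cong suc (count-empty {n} ((zero ≟_) ∘ suc) λ _ ())
count-singleton {suc n} (suc a) =
  trans (count-cong ((suc a ≟_) ∘ suc) (a ≟_) (suc-injective , cong suc)) (count-singleton a)

Image : (Fin k → Fin n) → Pred (Fin n) _
Image e x = ∃ λ i → e i ≡ x

image? : (e : Fin k → Fin n) → Decidable (Image e)
image? e x = any? λ i → e i ≟ x

count-image : (e : Fin k → Fin n) → Injective _≡_ _≡_ e → count (image? e) ≡ k
count-image {zero}  e _   = count-empty (image? e) λ _ ()
count-image {suc k} e inj = begin
  count (image? e)
    ≡⟨ count-split (image? e) (image? (e ∘ suc)) ⟩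
  count (image? e ∩? image? (e ∘ suc)) + count (image? e ∩? ∁? (image? (e ∘ suc)))
    ≡⟨ cong₂ _+_ (count-cong _ (image? (e ∘ suc)) tail-image) (count-cong _ (e zero ≟_) head-image) ⟩
  count (image? (e ∘ suc)) + count (e zero ≟_)
    ≡⟨ cong₂ _+_ (count-image (e ∘ suc) (suc-injective ∘ inj)) (count-singleton (e zero)) ⟩
  k + 1
    ≡⟨ +-comm k 1 ⟩
  suc k
    ∎
  where
  open ≡-Reasoning
  tail-image : Image e ∩ Image (e ∘ suc) ≐ Image (e ∘ suc)
  tail-image = proj₂ , λ { (i , p) → (suc i , p) , (i , p) }
  head-image : Image e ∩ ∁ (Image (e ∘ suc)) ≐ (e zero ≡_)
  head-image = (λ { ((zero , p) , _) → p ; ((suc i , p) , ∉tail) → contradiction (i , p) ∉tail })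
             , λ p → (zero , p) , λ { (i , q) → 0≢1+n (inj (trans p (sym q))) }

module _ {κ : ℕ} {_∼_ : Rel (Fin n) 0ℓ} (isEquivalence : IsEquivalence _∼_)
         (_∼?_ : ∀ x → Decidable (x ∼_)) (class-size : ∀ x → count (x ∼?_) ≡ κ) where

  open IsEquivalence isEquivalence renaming (refl to ∼-refl; sym to ∼-sym; trans to ∼-trans)

  count-without-class : {P : Pred (Fin n) 0ℓ} (P? : Decidable P) → P Respects _∼_ →
                        ∀ {x} → P x → count P? ≡ κ + count (P? ∩? ∁? (x ∼?_))
  count-without-class {P} P? resp {x} px = begin
    count P?                          ≡⟨ count-split P? (x ∼?_) ⟩
    count (P? ∩? (x ∼?_)) + rest      ≡⟨ cong (_+ rest) (count-cong _ (x ∼?_) class⊆P) ⟩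
    count (x ∼?_) + rest              ≡⟨ cong (_+ rest) (class-size x) ⟩
    κ + rest                          ∎
    where
    open ≡-Reasoning
    rest : ℕ
    rest = count (P? ∩? ∁? (x ∼?_))
    class⊆P : P ∩ (x ∼_) ≐ (x ∼_)
    class⊆P = proj₂ , λ x∼y → resp x∼y px , x∼y

  without-class-respects : {P : Pred (Fin n) 0ℓ} → P Respects _∼_ →
                           ∀ x → (P ∩ ∁ (x ∼_)) Respects _∼_
  without-class-respects resp x y∼z (py , x≁y) =
    resp y∼z py , λ x∼z → x≁y (∼-trans x∼z (∼-sym y∼z))

  saturated⇒∣count : {P : Pred (Fin n) 0ℓ} (P? : Decidable P) → P Respects _∼_ →
                     Acc _<_ (count P?) → κ ∣ count P?
  saturated⇒∣count P? resp (acc smaller) with any? P?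
  ... | no ∄P        = subst (κ ∣_) (sym (count-empty P? λ x px → ∄P (x , px))) (κ ∣0)
  ... | yes (x , px) = subst (κ ∣_) (sym split) (∣m∣n⇒∣m+n ∣-refl rest)
    where
    rest-count : ℕ
    rest-count = count (P? ∩? ∁? (x ∼?_))
    split : count P? ≡ κ + rest-count
    split = count-without-class P? resp px
    κ>0 : 0 < κ
    κ>0 = subst (0 <_) (class-size x) (count-pos (x ∼?_) ∼-refl)
    rest : κ ∣ rest-count
    rest = saturated⇒∣count _ (without-class-respects resp x)
             (smaller (subst (rest-count <_) (sym split) (m<n+m rest-count κ>0)))

  equal-classes⇒∣ : κ ∣ n
  equal-classes⇒∣ = subst (κ ∣_) count-U (saturated⇒∣count U? (λ _ _ → _) (<-wellFounded _))

commute-⟨$⟩ˡ : (f π : Permutation′ n) → (∀ d → f ⟨$⟩ʳ (π ⟨$⟩ʳ d) ≡ π ⟨$⟩ʳ (f ⟨$⟩ʳ d)) →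
               ∀ d → f ⟨$⟩ʳ (π ⟨$⟩ˡ d) ≡ π ⟨$⟩ˡ (f ⟨$⟩ʳ d)
commute-⟨$⟩ˡ f π commutes d = begin
  f ⟨$⟩ʳ (π ⟨$⟩ˡ d)                      ≡⟨ inverseˡ π ⟨
  π ⟨$⟩ˡ (π ⟨$⟩ʳ (f ⟨$⟩ʳ (π ⟨$⟩ˡ d)))    ≡⟨ cong (π ⟨$⟩ˡ_) (commutes (π ⟨$⟩ˡ d)) ⟨
  π ⟨$⟩ˡ (f ⟨$⟩ʳ (π ⟨$⟩ʳ (π ⟨$⟩ˡ d)))    ≡⟨ cong (λ y → π ⟨$⟩ˡ (f ⟨$⟩ʳ y)) (inverseʳ π) ⟩
  π ⟨$⟩ˡ (f ⟨$⟩ʳ d)                      ∎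
  where open ≡-Reasoning

module _ {n : ℕ} (R L : Permutation′ n) where

  private
    infixr 5 _·_
    _·_ : Word → Fin n → Fin n
    _·_ = act R L

  act-++ : ∀ u v d → (u ++ v) · d ≡ u · (v · d)
  act-++ []      v d = refl
  act-++ (x ∷ u) v d = cong (actL R L x) (act-++ u v d)

  actL-flipL-cancelˡ : ∀ x d → actL R L (flipL x) (actL R L x d) ≡ d
  actL-flipL-cancelˡ ρ⁺ d = inverseˡ R
  actL-flipL-cancelˡ ρ⁻ d = inverseʳ R
  actL-flipL-cancelˡ λ⁺ d = inverseˡ L
  actL-flipL-cancelˡ λ⁻ d = inverseʳ L

  actL-flipL-cancelʳ : ∀ x d → actL R L x (actL R L (flipL x) d) ≡ d
  actL-flipL-cancelʳ ρ⁺ d = inverseʳ R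
  actL-flipL-cancelʳ ρ⁻ d = inverseˡ R
  actL-flipL-cancelʳ λ⁺ d = inverseʳ L
  actL-flipL-cancelʳ λ⁻ d = inverseˡ L

  inv-∷ : ∀ x w → inv (x ∷ w) ≡ inv w ++ flipL x ∷ []
  inv-∷ x w = unfold-reverse (flipL x) (map flipL w)

  act-inv-cancelˡ : ∀ w d → inv w · (w · d) ≡ d
  act-inv-cancelˡ []      d = refl
  act-inv-cancelˡ (x ∷ w) d = begin
    inv (x ∷ w) · (x ∷ w) · d                        ≡⟨ cong (_· (x ∷ w) · d) (inv-∷ x w) ⟩
    (inv w ++ flipL x ∷ []) · (x ∷ w) · d            ≡⟨ act-++ (inv w) _ _ ⟩
    inv w · actL R L (flipL x) (actL R L x (w · d))  ≡⟨ cong (inv w ·_) (actL-flipL-cancelˡ x _) ⟩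
    inv w · (w · d)                                  ≡⟨ act-inv-cancelˡ w d ⟩
    d                                                ∎
    where open ≡-Reasoning

  act-inv-cancelʳ : ∀ w d → w · (inv w · d) ≡ d
  act-inv-cancelʳ []      d = refl
  act-inv-cancelʳ (x ∷ w) d = begin
    (x ∷ w) · (inv (x ∷ w) · d)                      ≡⟨ cong (λ v → (x ∷ w) · (v · d)) (inv-∷ x w) ⟩
    (x ∷ w) · ((inv w ++ flipL x ∷ []) · d)          ≡⟨ cong ((x ∷ w) ·_) (act-++ (inv w) _ d) ⟩
    actL R L x (w · (inv w · actL R L (flipL x) d))  ≡⟨ cong (actL R L x) (act-inv-cancelʳ w _) ⟩
    actL R L x (actL R L (flipL x) d)                ≡⟨ actL-flipL-cancelʳ x d ⟩
    d                                                ∎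
    where open ≡-Reasoning

  act-⟶ : ∀ {u v} → u ⟶ v → ∀ d → u · d ≡ v · d
  act-⟶ (cancel u x v) d = begin
    (u ++ x ∷ flipL x ∷ v) · d                   ≡⟨ act-++ u _ d ⟩
    u · actL R L x (actL R L (flipL x) (v · d))  ≡⟨ cong (u ·_) (actL-flipL-cancelʳ x _) ⟩
    u · (v · d)                                  ≡⟨ act-++ u v d ⟨
    (u ++ v) · d                                 ∎
    where open ≡-Reasoning

  act-≈ : ∀ {u v} → u ≈ v → ∀ d → u · d ≡ v · d
  act-≈ ≈-refl           d = refl
  act-≈ (≈-step u⟶v v≈w) d = trans (act-⟶ u⟶v d) (act-≈ v≈w d)
  act-≈ (≈-back v⟶u v≈w) d = trans (sym (act-⟶ v⟶u d)) (act-≈ v≈w d)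

  automorphism-act : ∀ f → IsAutomorphism R L f → ∀ w d → f ⟨$⟩ʳ (w · d) ≡ w · (f ⟨$⟩ʳ d)
  automorphism-act f _   []      d = refl
  automorphism-act f aut@(f∘R≡R∘f , f∘L≡L∘f) (x ∷ w) d =
    trans (commutes x (w · d)) (cong (actL R L x) (automorphism-act f aut w d))
    where
    commutes : ∀ x d → f ⟨$⟩ʳ actL R L x d ≡ actL R L x (f ⟨$⟩ʳ d)
    commutes ρ⁺ = f∘R≡R∘f
    commutes ρ⁻ = commute-⟨$⟩ˡ f R f∘R≡R∘f
    commutes λ⁺ = f∘L≡L∘f
    commutes λ⁻ = commute-⟨$⟩ˡ f L f∘L≡L∘f

  act≡⇒inv-++-fixes : ∀ v u {d} → v · d ≡ u · d → (inv v ++ u) · d ≡ d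
  act≡⇒inv-++-fixes v u {d} v·d≡u·d = begin
    (inv v ++ u) · d  ≡⟨ act-++ (inv v) u d ⟩
    inv v · u · d     ≡⟨ cong (inv v ·_) v·d≡u·d ⟨
    inv v · v · d     ≡⟨ act-inv-cancelˡ v d ⟩
    d                 ∎
    where open ≡-Reasoning

  inv-++-fixes⇒act≡ : ∀ v u {d} → (inv v ++ u) · d ≡ d → v · d ≡ u · d
  inv-++-fixes⇒act≡ v u {d} fixes = begin
    v · d                  ≡⟨ cong (v ·_) fixes ⟨
    v · (inv v ++ u) · d   ≡⟨ cong (v ·_) (act-++ (inv v) u d) ⟩
    v · inv v · u · d      ≡⟨ act-inv-cancelʳ v (u · d) ⟩
    u · d                  ∎
    where open ≡-Reasoning

  AutomorphismsTransitive : Set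
  AutomorphismsTransitive =
    ∀ d d′ → Σ (Permutation′ n) λ f → IsAutomorphism R L f × f ⟨$⟩ʳ d ≡ d′

  fixes-everywhere : AutomorphismsTransitive → ∀ w {d} → w · d ≡ d → ∀ d′ → w · d′ ≡ d′
  fixes-everywhere transitive w {d} fixes d′ with transitive d d′
  ... | f , f-aut , refl = trans (sym (automorphism-act f f-aut w d)) (cong (f ⟨$⟩ʳ_) fixes)

  module _ (d₀ : Fin n) where

    InH-++ : ∀ {h h′} → InH R L d₀ h → InH R L d₀ h′ → InH R L d₀ (h ++ h′)
    InH-++ {h} {h′} h∈H h′∈H = trans (act-++ h h′ d₀) (trans (cong (h ·_) h′∈H) h∈H)

    InH-inv : ∀ {h} → InH R L d₀ h → InH R L d₀ (inv h)
    InH-inv {h} h∈H = trans (cong (inv h ·_) (sym h∈H)) (act-inv-cancelˡ h d₀)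

    InHr-++ : ∀ {u v} → InHr R L d₀ u → InHr R L d₀ v → InHr R L d₀ (u ++ v)
    InHr-++ (h , h∈H , refl) (h′ , h′∈H , refl) =
      h ++ h′ , InH-++ {h} {h′} h∈H h′∈H , sym (map-++ flipL h h′)

    InHr-inv : ∀ {u} → InHr R L d₀ u → InHr R L d₀ (inv u)
    InHr-inv (h , h∈H , refl) =
      inv h , InH-inv {h} h∈H , sym (reverse-map flipL (map flipL h))

    _∼ʳ_ : Rel (Fin n) 0ℓ
    d ∼ʳ d′ = ∃ λ u → InHr R L d₀ u × u · d ≡ d′

    ∼ʳ-isEquivalence : IsEquivalence _∼ʳ_
    ∼ʳ-isEquivalence = record
      { refl  = [] , ([] , refl , refl) , refl
      ; sym   = λ { {d} (u , u∈Hr , refl) → inv u , InHr-inv u∈Hr , act-inv-cancelˡ u d }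
      ; trans = λ { {d} (u , u∈Hr , refl) (v , v∈Hr , refl) →
                      v ++ u , InHr-++ v∈Hr u∈Hr , act-++ v u d }
      }

    module _ (transitive : AutomorphismsTransitive) where

      act≡⇒SameCoset : ∀ v u {d} → v · d ≡ u · d → SameCoset R L d₀ v u
      act≡⇒SameCoset v u v·d≡u·d =
        fixes-everywhere transitive (inv v ++ u) (act≡⇒inv-++-fixes v u v·d≡u·d) d₀

      SameCoset⇒act≡ : ∀ v u → SameCoset R L d₀ v u → ∀ d → v · d ≡ u · d
      SameCoset⇒act≡ v u same-coset d =
        inv-++-fixes⇒act≡ v u (fixes-everywhere transitive (inv v ++ u) same-coset d)

      module _ {κ : ℕ} (cosets : IsChiralityIndex R L d₀ κ) where

        private
          rep : Fin κ → Word
          rep i = proj₁ (proj₁ cosets i)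

        rep-act-injective : ∀ d → Injective _≡_ _≡_ (λ i → rep i · d)
        rep-act-injective d {i} {j} =
          proj₁ (proj₂ cosets) i j ∘ act≡⇒SameCoset (rep i) (rep j)

        rep⇒∼ʳ : ∀ {d d′} → Image (λ i → rep i · d) d′ → d ∼ʳ d′
        rep⇒∼ʳ {d} (i , refl) with proj₂ (proj₁ cosets i)
        ... | h , u , h∈H , u∈Hr , rep-i≈h++u = u , u∈Hr , sym (begin
          rep i · d       ≡⟨ act-≈ rep-i≈h++u d ⟩
          (h ++ u) · d    ≡⟨ act-++ h u d ⟩
          h · u · d       ≡⟨ fixes-everywhere transitive h h∈H (u · d) ⟩
          u · d           ∎)
          where open ≡-Reasoning

        ∼ʳ⇒rep : ∀ {d d′} → d ∼ʳ d′ → Image (λ i → rep i · d) d′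
        ∼ʳ⇒rep {d} (u , u∈Hr , refl) with proj₂ (proj₂ cosets) (u , [] , u , refl , u∈Hr , ≈-refl)
        ... | i , same-coset = i , SameCoset⇒act≡ (rep i) u same-coset d

        _∼ʳ?_ : ∀ d → Decidable (d ∼ʳ_)
        d ∼ʳ? d′ = map′ rep⇒∼ʳ ∼ʳ⇒rep (image? (λ i → rep i · d) d′)

        ∼ʳ-class-size : ∀ d → count (d ∼ʳ?_) ≡ κ
        ∼ʳ-class-size d = trans (count-cong (d ∼ʳ?_) (image? _) (∼ʳ⇒rep , rep⇒∼ʳ))
                                (count-image _ (rep-act-injective d))

-- Only the transitivity of Aut(ℋ) on the darts is needed.
corollary6 : (n : ℕ) (R L : Permutation′ n) → Transitive R L → OrientablyRegular R L →
    (d₀ : Fin n) (κ : ℕ) → IsChiralityIndex R L d₀ κ → κ ∣ n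
corollary6 n R L _ (transitive , _) d₀ κ cosets =
  equal-classes⇒∣ (∼ʳ-isEquivalence R L d₀) (_∼ʳ?_ R L d₀ transitive cosets)
                  (∼ʳ-class-size R L d₀ transitive cosets)
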